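{- Let $P:\mathcal{C}^{op}\to\mathbf{InfSL}$ be an elementary, existential, implicational and universal doctrine with weak comprehensions, with $\mathcal{C}$ weakly cartesian closed, and let $A,B$ be objects of $\mathcal{C}$. Then the following are equivalent: (i) (AUC) holds from $A$ to $B$ in $P$; (ii) (AUC) holds from $(A,\delta_A)$ to $(B,\delta_B)$ in $\overline{P}$.
   Context: A primary doctrine is a functor $P:\mathcal{C}^{op}\to\mathbf{InfSL}$, $\mathcal{C}$ with finite products, each $P(A)$ a poset with finite meets ($\wedge$, top $\top_A$) preserved by each $P_f$. Write $f\times f'=\langle f\circ pr_1,f'\circ pr_2\rangle$, $\Delta_A=\langle id_A,id_A\rangle$. $P$ is elementary if each $P_{id_C\times\Delta_A}$ has a left adjoint $\exists_{id_C\times\Delta_A}$ satisfying Frobenius reciprocity; $\delta_A=\exists_{\Delta_A}(\top_A)$. $P$ is existential (resp. universal) if for each product projection $pr$, $P_{pr}$ has a left adjoint $\exists_{pr}$ satisfying Beck–Chevalley and Frobenius (resp. a right adjoint $\forall_{pr}$ satisfying Beck–Chevalley) with respect to pullbacks of projections; implicational if each $\alpha\wedge-$ has a right adjoint $\alpha\Rightarrow-$. A weak comprehension of $\alpha\in P(A)$ is $\{\alpha\}:X\to A$ with $\top_X\le P_{\{\alpha\}}(\alpha)$ through which every $g:Y\to A$ with $\top_Y\le P_g(\alpha)$ factors (not necessarily uniquely). A weak evaluation from $A$ to $B$ is $w:[B^A]\times A\to B$ such that every $f:X\times A\to B$ is $w\circ(f'\times id_A)$ for some $f'$; $\mathcal{C}$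 is weakly cartesian closed if these exist for all $A,B$. (AUC) holds for $w$ in $P$ if for every $\rho\in P(A\times B)$, in $P(1)$: $$\forall_{A\to1}\exists_{A\times B\to A}(\rho)\wedge\forall_{B\times B\to1}\forall_{A\times B\times B\to B\times B}\big((P_{\langle pr_1,pr_2\rangle}(\rho)\wedge P_{\langle pr_1,pr_3\rangle}(\rho))\Rightarrow P_{\langle pr_2,pr_3\rangle}(\delta_B)\big)\le\exists_{[B^A]\to1}\forall_{[B^A]\times A\to[B^A]}P_{\langle pr_2',w\rangle}(\rho),$$ where all arrows named are the evident projections, $pr_1,pr_2,pr_3$ are the projections of $A\times B\times B$ and $pr_2':[B^A]\times A\to A$. (The paper notes that holding for one weak evaluation from $A$ to $B$ is equivalent to holding for every one; "(AUC) holds from $A$ to $B$" means it holds for a weak evaluation from $A$ to $B$.) A $P$-equivalence relation on $A$ is $\rho\in P(A\times A)$ reflexive ($\delta_A\le\rho$), symmetric and transitive; $\mathrm{des}(\rho)=\{\alpha\in P(A):P_{pr_1}(\alpha)\wedge\rho\le P_{pr_2}(\alpha)\}$. The elementary quotient completion $\overline{P}:\mathcal{Q}_P^{op}\to\mathbf{InfSL}$: objects $(A,\rho)$, $\rho$ a $P$-equivalence relation on $A$; arrows $(A,\rho)\to(B,\sigma)$ are classes $[f]$ of $f:A\to B$ with $\rho\le P_{f\times f}(\sigma)$ modulo $f\sim g$ iff $\rho\le P_{f\times g}(\sigma)$; $\overline{P}(A,\rho)=\mathrm{des}(\rho)$ with reindexing $P_f$. Under the hypotheses, $\overline{P}$ is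 again elementary, existential, implicational, universal, and $\mathcal{Q}_P$ is cartesian closed, so (AUC) makes sense in $\overline{P}$. -}

module Defs where

open import Level using (Level; _⊔_) renaming (suc to lsuc)
open import Data.Product using (Σ; _×_; _,_; proj₁; proj₂)
open import Relation.Binary using (IsEquivalence)

record CartCat (o h e : Level) : Set (lsuc (o ⊔ h ⊔ e)) where
  infixr 9 _∘_
  infix 4 _≈_
  infixr 7 _⊗_
  field
    Ob     : Set o
    Hom    : Ob → Ob → Set h
    _≈_    : ∀ {A B} → Hom A B → Hom A B → Set e
    ≈-equiv : ∀ {A B} → IsEquivalence (_≈_ {A} {B})
    id     : ∀ {A} → Hom A A
    _∘_    : ∀ {A B C} → Hom B C → Hom A B → Hom A C
    ∘-resp-≈ : ∀ {A B C} {f f' : Hom B C} {g g' : Hom A B} →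
               f ≈ f' → g ≈ g' → f ∘ g ≈ f' ∘ g'
    assoc  : ∀ {A B C D} {f : Hom A B} {g : Hom B C} {k : Hom C D} →
             (k ∘ g) ∘ f ≈ k ∘ (g ∘ f)
    idˡ    : ∀ {A B} {f : Hom A B} → id ∘ f ≈ f
    idʳ    : ∀ {A B} {f : Hom A B} → f ∘ id ≈ f
    𝟙      : Ob
    !      : ∀ {A} → Hom A 𝟙
    !-unique : ∀ {A} (f : Hom A 𝟙) → f ≈ !
    _⊗_    : Ob → Ob → Ob
    π₁     : ∀ {A B} → Hom (A ⊗ B) A
    π₂     : ∀ {A B} → Hom (A ⊗ B) B
    ⟨_,_⟩  : ∀ {X A B} → Hom X A → Hom X B → Hom X (A ⊗ B)
    π₁-β   : ∀ {X A B} {f : Hom X A} {g : Hom X B} → π₁ ∘ ⟨ f , g ⟩ ≈ f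
    π₂-β   : ∀ {X A B} {f : Hom X A} {g : Hom X B} → π₂ ∘ ⟨ f , g ⟩ ≈ g
    ⟨⟩-unique : ∀ {X A B} {f : Hom X A} {g : Hom X B} {k : Hom X (A ⊗ B)} →
                π₁ ∘ k ≈ f → π₂ ∘ k ≈ g → k ≈ ⟨ f , g ⟩

  _×ₘ_ : ∀ {A A' B B'} → Hom A B → Hom A' B' → Hom (A ⊗ A') (B ⊗ B')
  f ×ₘ f' = ⟨ f ∘ π₁ , f' ∘ π₂ ⟩

  Δ : ∀ {A} → Hom A (A ⊗ A)
  Δ = ⟨ id , id ⟩

  record WeakEval (A B : Ob) : Set (o ⊔ h ⊔ e) where
    field
      E      : Ob
      ev     : Hom (E ⊗ A) B
      factor : ∀ {X} (f : Hom (X ⊗ A) B) →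
               Σ (Hom X E) λ f' → f ≈ ev ∘ (f' ×ₘ id)

  WeaklyCCC : Set (o ⊔ h ⊔ e)
  WeaklyCCC = ∀ A B → WeakEval A B

-- Primary doctrines P : C^op → InfSL.
-- Each P(A) is presented as a preorder; the poset P(A) is its quotient
-- by  α ≤ β × β ≤ α ; functor laws hold in that quotient.

record PrimaryDoctrine {o h e} (𝒞 : CartCat o h e) (p l : Level)
       : Set (lsuc (o ⊔ h ⊔ e ⊔ p ⊔ l)) where
  open CartCat 𝒞
  infix 4 _≤_
  infixr 6 _∧_
  field
    P      : Ob → Set p
    _≤_    : ∀ {A} → P A → P A → Set l
    ≤-refl : ∀ {A} {α : P A} → α ≤ α
    ≤-trans : ∀ {A} {α β γ : P A} → α ≤ β → β ≤ γ → α ≤ γ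
    ⊤      : ∀ {A} → P A
    _∧_    : ∀ {A} → P A → P A → P A
    ⊤-max  : ∀ {A} {α : P A} → α ≤ ⊤
    ∧-π₁   : ∀ {A} {α β : P A} → α ∧ β ≤ α
    ∧-π₂   : ∀ {A} {α β : P A} → α ∧ β ≤ β
    ∧-univ : ∀ {A} {α β γ : P A} → γ ≤ α → γ ≤ β → γ ≤ α ∧ β
    re     : ∀ {A B} → Hom A B → P B → P A
    re-mono : ∀ {A B} {f : Hom A B} {α β : P B} → α ≤ β → re f α ≤ re f β
    re-resp : ∀ {A B} {f g : Hom A B} {α : P B} → f ≈ g → re f α ≤ re g α
    re-id₁ : ∀ {A} {α : P A} → re id α ≤ α
    re-id₂ : ∀ {A} {α : P A} → α ≤ re id α
    re-∘₁  : ∀ {A B C} {f : Hom A B} {g : Hom B C} {α : P C} →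
             re (g ∘ f) α ≤ re f (re g α)
    re-∘₂  : ∀ {A B C} {f : Hom A B} {g : Hom B C} {α : P C} →
             re f (re g α) ≤ re (g ∘ f) α
    re-⊤   : ∀ {A B} {f : Hom A B} → ⊤ ≤ re f ⊤
    re-∧   : ∀ {A B} {f : Hom A B} {α β : P B} → re f α ∧ re f β ≤ re f (α ∧ β)

module _ {o h e p l} {𝒞 : CartCat o h e} (D : PrimaryDoctrine 𝒞 p l) where
  open CartCat 𝒞
  open PrimaryDoctrine D

  record Elementary : Set (o ⊔ h ⊔ e ⊔ p ⊔ l) where
    field
      ∃Δ      : ∀ {C A} → P (C ⊗ A) → P (C ⊗ (A ⊗ A))
      ∃Δ-adj₁ : ∀ {C A} {α : P (C ⊗ A)} {β} → ∃Δ α ≤ β → α ≤ re (id ×ₘ Δ) β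
      ∃Δ-adj₂ : ∀ {C A} {α : P (C ⊗ A)} {β} → α ≤ re (id ×ₘ Δ) β → ∃Δ α ≤ β
      ∃Δ-frob₁ : ∀ {C A} {α : P (C ⊗ A)} {β} →
                 ∃Δ (re (id ×ₘ Δ) β ∧ α) ≤ β ∧ ∃Δ α
      ∃Δ-frob₂ : ∀ {C A} {α : P (C ⊗ A)} {β} →
                 β ∧ ∃Δ α ≤ ∃Δ (re (id ×ₘ Δ) β ∧ α)

  -- existential: left adjoints ∃ to P_{pr₁} (pr₁ : X × Y → X), with
  -- Beck–Chevalley (pullback of pr₁ along f is pr₁ with f × id) and Frobenius
  record Existential : Set (o ⊔ h ⊔ e ⊔ p ⊔ l) where
    field
      ∃π      : ∀ {X Y} → P (X ⊗ Y) → P X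
      ∃π-adj₁ : ∀ {X Y} {α : P (X ⊗ Y)} {β} → ∃π α ≤ β → α ≤ re π₁ β
      ∃π-adj₂ : ∀ {X Y} {α : P (X ⊗ Y)} {β} → α ≤ re π₁ β → ∃π α ≤ β
      ∃π-BC₁  : ∀ {Z X Y} {f : Hom Z X} {α : P (X ⊗ Y)} →
                re f (∃π α) ≤ ∃π (re (f ×ₘ id) α)
      ∃π-BC₂  : ∀ {Z X Y} {f : Hom Z X} {α : P (X ⊗ Y)} →
                ∃π (re (f ×ₘ id) α) ≤ re f (∃π α)
      ∃π-frob₁ : ∀ {X Y} {α : P (X ⊗ Y)} {β} → ∃π (re π₁ β ∧ α) ≤ β ∧ ∃π α
      ∃π-frob₂ : ∀ {X Y} {α : P (X ⊗ Y)} {β} → β ∧ ∃π α ≤ ∃π (re π₁ β ∧ α)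

  record Universal : Set (o ⊔ h ⊔ e ⊔ p ⊔ l) where
    field
      ∀π      : ∀ {X Y} → P (X ⊗ Y) → P X
      ∀π-adj₁ : ∀ {X Y} {α : P (X ⊗ Y)} {β} → β ≤ ∀π α → re π₁ β ≤ α
      ∀π-adj₂ : ∀ {X Y} {α : P (X ⊗ Y)} {β} → re π₁ β ≤ α → β ≤ ∀π α
      ∀π-BC₁  : ∀ {Z X Y} {f : Hom Z X} {α : P (X ⊗ Y)} →
                re f (∀π α) ≤ ∀π (re (f ×ₘ id) α)
      ∀π-BC₂  : ∀ {Z X Y} {f : Hom Z X} {α : P (X ⊗ Y)} →
                ∀π (re (f ×ₘ id) α) ≤ re f (∀π α)

  record Implicational : Set (o ⊔ h ⊔ e ⊔ p ⊔ l) where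
    field
      _⇒_    : ∀ {A} → P A → P A → P A
      ⇒-adj₁ : ∀ {A} {α β γ : P A} → α ∧ β ≤ γ → β ≤ α ⇒ γ
      ⇒-adj₂ : ∀ {A} {α β γ : P A} → β ≤ α ⇒ γ → α ∧ β ≤ γ

  record WeakComprehension {A} (α : P A) : Set (o ⊔ h ⊔ e ⊔ l) where
    field
      X      : Ob
      cmp    : Hom X A
      cmp-⊤  : ⊤ ≤ re cmp α
      factor : ∀ {Y} (g : Hom Y A) → ⊤ ≤ re g α →
               Σ (Hom Y X) λ k → g ≈ cmp ∘ k

  WeakComprehensions : Set (o ⊔ h ⊔ e ⊔ p ⊔ l)
  WeakComprehensions = ∀ {A} (α : P A) → WeakComprehension α

module AUCTheory {o h e p l} {𝒞 : CartCat o h e} (D : PrimaryDoctrine 𝒞 p l)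
       (El : Elementary D) (Ex : Existential D) (Un : Universal D)
       (Im : Implicational D) where
  open CartCat 𝒞
  open PrimaryDoctrine D
  open Elementary El
  open Existential Ex
  open Universal Un
  open Implicational Im

  -- δ_A = ∃_{Δ_A}(⊤_A), computed as ∃_{id_1 × Δ_A} along A ≅ 1 × A
  δ : ∀ {A} → P (A ⊗ A)
  δ {A} = re ⟨ ! , id ⟩ (∃Δ {𝟙} {A} ⊤)

  -- ∃_{A→1}, ∀_{A→1}, computed as ∃_{pr₁}, ∀_{pr₁} along A ≅ 1 × A
  ∃₁ : ∀ {A} → P A → P 𝟙
  ∃₁ {A} α = ∃π {𝟙} {A} (re π₂ α)

  ∀₁ : ∀ {A} → P A → P 𝟙
  ∀₁ {A} α = ∀π {𝟙} {A} (re π₂ α)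

  -- The triple product A × B × B is taken as (B × B) × A, with
  -- pr₁ = π₂ , pr₂ = π₁ ∘ π₁ , pr₃ = π₂ ∘ π₁  (so that the projection
  -- A × B × B → B × B is π₁).
  AUC-lhs : ∀ {A B} → P (A ⊗ B) → P 𝟙
  AUC-lhs {A} {B} ρ =
    ∀₁ (∃π {A} {B} ρ)
    ∧ ∀₁ {B ⊗ B} (∀π {B ⊗ B} {A}
          ((re ⟨ π₂ , π₁ ∘ π₁ ⟩ ρ ∧ re ⟨ π₂ , π₂ ∘ π₁ ⟩ ρ)
            ⇒ re ⟨ π₁ ∘ π₁ , π₂ ∘ π₁ ⟩ (δ {B})))

  AUC-rhs : ∀ {A B E} → Hom (E ⊗ A) B → P (A ⊗ B) → P 𝟙
  AUC-rhs {A} {B} {E} w ρ = ∃₁ {E} (∀π {E} {A} (re ⟨ π₂ , w ⟩ ρ))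

  AUC : ∀ {A B E} → Hom (E ⊗ A) B → Set (p ⊔ l)
  AUC {A} {B} w = (ρ : P (A ⊗ B)) → AUC-lhs ρ ≤ AUC-rhs w ρ

  AUC-from : Ob → Ob → Set (o ⊔ h ⊔ e ⊔ p ⊔ l)
  AUC-from A B = Σ (WeakEval A B) λ W → AUC (WeakEval.ev W)

  IsEqRel : ∀ {A} → P (A ⊗ A) → Set l
  IsEqRel {A} ρ =
    (δ ≤ ρ)
    × (ρ ≤ re ⟨ π₂ , π₁ ⟩ ρ)
    × (re ⟨ π₁ ∘ π₁ , π₂ ∘ π₁ ⟩ ρ ∧ re ⟨ π₂ ∘ π₁ , π₂ ⟩ ρ
         ≤ re ⟨ π₁ ∘ π₁ , π₂ ⟩ ρ)   -- on (A × A) × A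

  des : ∀ {A} → P (A ⊗ A) → P A → Set l
  des ρ α = re π₁ α ∧ ρ ≤ re π₂ α

  -- f : A → B represents an arrow (A,ρ) → (B,σ) of Q_P
  IsQArr : ∀ {A B} → P (A ⊗ A) → P (B ⊗ B) → Hom A B → Set l
  IsQArr ρ σ f = ρ ≤ re (f ×ₘ f) σ

  -- equality of arrows of Q_P:  f ∼ g  iff  ρ ≤ P_{f×g}(σ)
  QEq : ∀ {A B} → P (A ⊗ A) → P (B ⊗ B) → Hom A B → Hom A B → Set l
  QEq ρ σ f g = ρ ≤ re (f ×ₘ g) σ

  -- the product (A,ρ) × (B,σ) = (A × B, ρ ⊠ σ) in Q_P
  _⊠_ : ∀ {A B} → P (A ⊗ A) → P (B ⊗ B) → P ((A ⊗ B) ⊗ (A ⊗ B))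
  ρ ⊠ σ = re ⟨ π₁ ∘ π₁ , π₁ ∘ π₂ ⟩ ρ ∧ re ⟨ π₂ ∘ π₁ , π₂ ∘ π₂ ⟩ σ

  record QWeakEval (A B : Ob) : Set (o ⊔ h ⊔ e ⊔ p ⊔ l) where
    field
      E      : Ob
      ε      : P (E ⊗ E)
      ε-eq   : IsEqRel ε
      ev     : Hom (E ⊗ A) B
      ev-arr : IsQArr (ε ⊠ δ {A}) (δ {B}) ev
      factor : ∀ {X} (ξ : P (X ⊗ X)) → IsEqRel ξ →
               (f : Hom (X ⊗ A) B) → IsQArr (ξ ⊠ δ {A}) (δ {B}) f →
               Σ (Hom X E) λ f' →
                 IsQArr ξ ε f'
                 × QEq (ξ ⊠ δ {A}) (δ {B}) f (ev ∘ (f' ×ₘ id))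

  -- P̄((A,δ_A) × (B,δ_B)) = des(δ_A ⊠ δ_B); the structure of P̄
  -- (order, meets, reindexing, ∃, ∀, ⇒ and δ̄_{(B,δ_B)} = δ_B,
  -- P̄(1,δ_1) = des(δ_1)) is computed as in P.
  AUC̄ : ∀ {A B E} → Hom (E ⊗ A) B → Set (p ⊔ l)
  AUC̄ {A} {B} w = (ρ : P (A ⊗ B)) → des (δ {A} ⊠ δ {B}) ρ →
                   AUC-lhs ρ ≤ AUC-rhs w ρ

  AUC̄-from : Ob → Ob → Set (o ⊔ h ⊔ e ⊔ p ⊔ l)
  AUC̄-from A B = Σ (QWeakEval A B) λ W → AUC̄ (QWeakEval.ev W)

{-# OPTIONS --safe #-}
module Submission where

open import Data.Product using (Σ; _×_; _,_)
open import Relation.Binary using (IsEquivalence)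
open import Defs
open import Function.Bundles using (_⇔_; mk⇔)

-- A weak evaluation w : E × A → B of 𝒞 becomes one of 𝒬_P from (A,δ_A) to
-- (B,δ_B) once E is equipped with extensional equality ∀a. w(e,a) = w(e',a).
-- Conversely, a weak evaluation of 𝒬_P factors through one of 𝒞 along some g,
-- and (AUC) passes along g since its right-hand side is an existential over
-- codes.  Substitution along δ makes every predicate on A × B descent data for
-- δ_A ⊠ δ_B, so (AUC) has the same instances in P and in P̄.

module CategoryLemmas {o h e} (𝒞 : CartCat o h e) where
  open CartCat 𝒞
  module ≈ {A B} = IsEquivalence (≈-equiv {A} {B})

  infixr 4 _■_
  _■_ : ∀ {A B} {f g k : Hom A B} → f ≈ g → g ≈ k → f ≈ k
  _■_ = ≈.trans

  ∘ˡ : ∀ {A B C} {f f' : Hom B C} {g : Hom A B} → f ≈ f' → f ∘ g ≈ f' ∘ g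
  ∘ˡ p = ∘-resp-≈ p ≈.refl

  ∘ʳ : ∀ {A B C} {f : Hom B C} {g g' : Hom A B} → g ≈ g' → f ∘ g ≈ f ∘ g'
  ∘ʳ p = ∘-resp-≈ ≈.refl p

  ⟨⟩∘ : ∀ {X Y A B} {f : Hom Y A} {g : Hom Y B} {k : Hom X Y} →
        ⟨ f , g ⟩ ∘ k ≈ ⟨ f ∘ k , g ∘ k ⟩
  ⟨⟩∘ = ⟨⟩-unique (≈.sym assoc ■ ∘ˡ π₁-β) (≈.sym assoc ■ ∘ˡ π₂-β)

  ⟨⟩-cong : ∀ {X A B} {f f' : Hom X A} {g g' : Hom X B} →
            f ≈ f' → g ≈ g' → ⟨ f , g ⟩ ≈ ⟨ f' , g' ⟩
  ⟨⟩-cong p q = ⟨⟩-unique (π₁-β ■ p) (π₂-β ■ q)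

  ⟨⟩-η : ∀ {X A B} {k : Hom X (A ⊗ B)} → k ≈ ⟨ π₁ ∘ k , π₂ ∘ k ⟩
  ⟨⟩-η = ⟨⟩-unique ≈.refl ≈.refl

  ⟨⟩-ext : ∀ {X A B} {k k' : Hom X (A ⊗ B)} →
           π₁ ∘ k ≈ π₁ ∘ k' → π₂ ∘ k ≈ π₂ ∘ k' → k ≈ k'
  ⟨⟩-ext p q = ⟨⟩-unique p q ■ ≈.sym ⟨⟩-η

  ⟨π₁,π₂⟩≈id : ∀ {A B} → ⟨ π₁ , π₂ ⟩ ≈ id {A ⊗ B}
  ⟨π₁,π₂⟩≈id = ≈.sym (⟨⟩-unique idʳ idʳ)

  weaken-β : ∀ {Z Y W} {w : Hom Z W} {u : Hom Z Y} → (w ∘ π₁) ∘ ⟨ id , u ⟩ ≈ w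
  weaken-β = assoc ■ ∘ʳ π₁-β ■ idʳ

  pair-weakenʳ-β : ∀ {Z Y W} {w : Hom Z W} {u : Hom Z Y} →
                   ⟨ π₂ , w ∘ π₁ ⟩ ∘ ⟨ id , u ⟩ ≈ ⟨ u , w ⟩
  pair-weakenʳ-β = ⟨⟩∘ ■ ⟨⟩-cong π₂-β weaken-β

  pair-weakenˡ-β : ∀ {Z Y W} {w : Hom Z W} {u : Hom Z Y} →
                   ⟨ w ∘ π₁ , π₂ ⟩ ∘ ⟨ id , u ⟩ ≈ ⟨ w , u ⟩
  pair-weakenˡ-β = ⟨⟩∘ ■ ⟨⟩-cong weaken-β π₂-β

  swap : ∀ {X Y} → Hom (X ⊗ Y) (Y ⊗ X)
  swap = ⟨ π₂ , π₁ ⟩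

  swap-involutive : ∀ {X Y} → swap {Y} {X} ∘ swap {X} {Y} ≈ id
  swap-involutive = ⟨⟩∘ ■ ⟨⟩-cong π₂-β π₁-β ■ ⟨π₁,π₂⟩≈id

  ×ₘid∘⟨⟩ : ∀ {X Y Y' A} {g : Hom Y Y'} {q : Hom X Y} {r : Hom X A} →
            (g ×ₘ id) ∘ ⟨ q , r ⟩ ≈ ⟨ g ∘ q , r ⟩
  ×ₘid∘⟨⟩ = ⟨⟩∘ ■ ⟨⟩-cong (assoc ■ ∘ʳ π₁-β) (assoc ■ ∘ʳ π₂-β ■ idˡ)

module DoctrineLemmas {o h e p l} {𝒞 : CartCat o h e} (D : PrimaryDoctrine 𝒞 p l) where
  open CartCat 𝒞
  open PrimaryDoctrine D

  infixr 4 _⟫_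
  _⟫_ : ∀ {A} {α β γ : P A} → α ≤ β → β ≤ γ → α ≤ γ
  _⟫_ = ≤-trans

  re-fuse : ∀ {A B C} {f : Hom A B} {g : Hom B C} {k : Hom A C} {α : P C} →
            g ∘ f ≈ k → re f (re g α) ≤ re k α
  re-fuse q = re-∘₂ ⟫ re-resp q

  re-split : ∀ {A B C} {f : Hom A B} {g : Hom B C} {k : Hom A C} {α : P C} →
             k ≈ g ∘ f → re k α ≤ re f (re g α)
  re-split q = re-resp q ⟫ re-∘₁

  ∧-mono : ∀ {A} {α α' β β' : P A} → α ≤ α' → β ≤ β' → α ∧ β ≤ α' ∧ β'
  ∧-mono p q = ∧-univ (∧-π₁ ⟫ p) (∧-π₂ ⟫ q)

  re-∧⁻ : ∀ {A B} {f : Hom A B} {α β : P B} → re f (α ∧ β) ≤ re f α ∧ re f β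
  re-∧⁻ = ∧-univ (re-mono ∧-π₁) (re-mono ∧-π₂)

module AUCTransfer {o h e p l} (𝒞 : CartCat o h e) (D : PrimaryDoctrine 𝒞 p l)
         (El : Elementary D) (Ex : Existential D) (Un : Universal D)
         (Im : Implicational D) where
  open CartCat 𝒞
  open PrimaryDoctrine D
  open Elementary El
  open Existential Ex
  open Universal Un
  open AUCTheory D El Ex Un Im
  open CategoryLemmas 𝒞
  open DoctrineLemmas D

  ∀π-mono : ∀ {X Y} {α β : P (X ⊗ Y)} → α ≤ β → ∀π α ≤ ∀π β
  ∀π-mono H = ∀π-adj₂ (∀π-adj₁ ≤-refl ⟫ H)

  ∀π-inst : ∀ {Z X Y} {f : Hom Z X} {t : Hom Z Y} {α : P (X ⊗ Y)} →
            re f (∀π α) ≤ re ⟨ f , t ⟩ α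
  ∀π-inst = re-split (≈.sym π₁-β) ⟫ re-mono (∀π-adj₁ ≤-refl)

  δᶜ : ∀ {C Y} → P (C ⊗ (Y ⊗ Y))
  δᶜ {C} {Y} = ∃Δ {C} {Y} ⊤

  δᶜ-refl : ∀ {C Y} → ⊤ ≤ re (id ×ₘ Δ) (δᶜ {C} {Y})
  δᶜ-refl = ∃Δ-adj₁ ≤-refl

  δᶜ-elim : ∀ {C Y} {β γ : P (C ⊗ (Y ⊗ Y))} →
            re (id ×ₘ Δ) β ≤ re (id ×ₘ Δ) γ → β ∧ δᶜ ≤ γ
  δᶜ-elim H = ∃Δ-frob₂ {α = ⊤} ⟫ ∃Δ-adj₂ (∧-π₁ ⟫ H)

  -- δ is the parameter-free instance (C = 𝟙) of δᶜ; to use it in context C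
  -- we compare it with ∀c. δᶜ(c, y, y'), which is reflexive.
  ∀δᶜ : ∀ C Y → P (Y ⊗ Y)
  ∀δᶜ C Y = ∀π {Y ⊗ Y} {C} (re swap (δᶜ {C} {Y}))

  ∀δᶜ-refl : ∀ {C Y} → ⊤ ≤ re Δ (∀δᶜ C Y)
  ∀δᶜ-refl {C} {Y} =
    ∀π-adj₂ (⊤-max ⟫ re-⊤ ⟫ re-mono (δᶜ-refl {C} {Y}) ⟫ re-fuse Δ-swap ⟫ re-∘₁)
    ⟫ ∀π-BC₂
    where
      Δ-swap : (id ×ₘ Δ) ∘ swap {Y} {C} ≈ swap ∘ (Δ ×ₘ id)
      Δ-swap = ⟨⟩∘ ■ ⟨⟩-cong (assoc ■ idˡ ■ π₁-β) (assoc ■ ∘ʳ π₂-β)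
               ■ ≈.sym (⟨⟩∘ ■ ⟨⟩-cong (π₂-β ■ idˡ) π₁-β)

  δ≤∀δᶜ : ∀ {C Y} → δ ≤ ∀δᶜ C Y
  δ≤∀δᶜ {C} {Y} =
    re-mono (∧-univ ⊤-max ≤-refl) ⟫ re-mono (δᶜ-elim {𝟙} {Y} {⊤} H)
    ⟫ re-fuse π₂-β ⟫ re-id₁
    where
      H : re (id ×ₘ Δ) ⊤ ≤ re (id ×ₘ Δ) (re π₂ (∀δᶜ C Y))
      H = ⊤-max ⟫ re-⊤ ⟫ re-mono (∀δᶜ-refl {C} {Y}) ⟫ re-fuse (≈.sym π₂-β) ⟫ re-∘₁

  δ≤δᶜ : ∀ {C Y} → re π₂ (δ {Y}) ≤ δᶜ {C} {Y}
  δ≤δᶜ {C} {Y} =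
    re-split (≈.sym π₁-β) ⟫ re-mono (∀π-adj₁ (δ≤∀δᶜ {C} {Y}))
    ⟫ re-fuse swap-involutive ⟫ re-id₁

  δ-elim : ∀ {C Y} {β γ : P (C ⊗ (Y ⊗ Y))} →
           re (id ×ₘ Δ) β ≤ re (id ×ₘ Δ) γ → β ∧ re π₂ δ ≤ γ
  δ-elim H = ∧-mono ≤-refl δ≤δᶜ ⟫ δᶜ-elim H

  Eq : ∀ {Z Y} → Hom Z Y → Hom Z Y → P Z
  Eq u v = re ⟨ u , v ⟩ δ

  Eq-reindex : ∀ {X Z Y} {k : Hom X Z} {u v : Hom Z Y} →
               re k (Eq u v) ≤ Eq (u ∘ k) (v ∘ k)
  Eq-reindex = re-fuse ⟨⟩∘

  Eq-reindex⁻ : ∀ {X Z Y} {k : Hom X Z} {u v : Hom Z Y} →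
                Eq (u ∘ k) (v ∘ k) ≤ re k (Eq u v)
  Eq-reindex⁻ = re-split (≈.sym ⟨⟩∘)

  Eq-resp : ∀ {Z Y} {u u' v v' : Hom Z Y} → u ≈ u' → v ≈ v' → Eq u v ≤ Eq u' v'
  Eq-resp p q = re-resp (⟨⟩-cong p q)

  Eq-refl : ∀ {Z Y} (u : Hom Z Y) → ⊤ ≤ Eq u u
  Eq-refl u = re-⊤ ⟫ re-mono δᶜ-refl ⟫ re-fuse Δ-factor ⟫ re-∘₁
    where
      Δ-factor : (id ×ₘ Δ) ∘ ⟨ ! , u ⟩ ≈ ⟨ ! , id ⟩ ∘ ⟨ u , u ⟩
      Δ-factor =
        ⟨⟩-ext (!-unique _ ■ ≈.sym (!-unique _))
          ((≈.sym assoc ■ ∘ˡ π₂-β ■ assoc ■ ∘ʳ π₂-β ■ ⟨⟩∘ ■ ⟨⟩-cong idˡ idˡ)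
           ■ ≈.sym (≈.sym assoc ■ ∘ˡ π₂-β ■ idˡ))

  Eq-subst : ∀ {Z Y} (α : P (Z ⊗ Y)) (u v : Hom Z Y) →
             Eq u v ∧ re ⟨ id , u ⟩ α ≤ re ⟨ id , v ⟩ α
  Eq-subst {Z} {Y} α u v =
    ∧-univ (∧-π₂ ⟫ re-split at-u) (∧-π₁ ⟫ re-split (≈.sym π₂-β)) ⟫ re-∧
    ⟫ re-mono (δ-elim {Z} {Y} {α₁} {α₂} (re-fuse on-diagonal ⟫ re-∘₁)) ⟫ re-fuse at-v
    where
      α₁ α₂ : P (Z ⊗ (Y ⊗ Y))
      α₁ = re ⟨ π₁ , π₁ ∘ π₂ ⟩ α
      α₂ = re ⟨ π₁ , π₂ ∘ π₂ ⟩ α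
      k : Hom Z (Z ⊗ (Y ⊗ Y))
      k = ⟨ id , ⟨ u , v ⟩ ⟩
      π₂-Δ : ∀ {Y'} {q : Hom (Y ⊗ Y) Y'} {r : Hom Y Y'} → q ∘ Δ ≈ r →
             (q ∘ π₂) ∘ (id ×ₘ Δ {Y}) ≈ r ∘ π₂ {Z}
      π₂-Δ qr = assoc ■ ∘ʳ π₂-β ■ ≈.sym assoc ■ ∘ˡ qr
      on-diagonal : ⟨ π₁ , π₁ ∘ π₂ ⟩ ∘ (id ×ₘ Δ) ≈ ⟨ π₁ , π₂ ∘ π₂ ⟩ ∘ (id ×ₘ Δ {Y})
      on-diagonal = ⟨⟩∘ ■ ⟨⟩-cong ≈.refl (π₂-Δ π₁-β ■ ≈.sym (π₂-Δ π₂-β)) ■ ≈.sym ⟨⟩∘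
      at-u : ⟨ id , u ⟩ ≈ ⟨ π₁ , π₁ ∘ π₂ ⟩ ∘ k
      at-u = ≈.sym (⟨⟩∘ ■ ⟨⟩-cong π₁-β (assoc ■ ∘ʳ π₂-β ■ π₁-β))
      at-v : ⟨ π₁ , π₂ ∘ π₂ ⟩ ∘ k ≈ ⟨ id , v ⟩
      at-v = ⟨⟩∘ ■ ⟨⟩-cong π₁-β (assoc ■ ∘ʳ π₂-β ■ π₂-β)

  Eq-subst-Eq : ∀ {Z Y W} (s t : Hom (Z ⊗ Y) W) (u v : Hom Z Y) →
                Eq u v ∧ Eq (s ∘ ⟨ id , u ⟩) (t ∘ ⟨ id , u ⟩)
                  ≤ Eq (s ∘ ⟨ id , v ⟩) (t ∘ ⟨ id , v ⟩)
  Eq-subst-Eq s t u v = ∧-mono ≤-refl Eq-reindex⁻ ⟫ Eq-subst (Eq s t) u v ⟫ Eq-reindex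

  Eq-sym : ∀ {Z Y} {u v : Hom Z Y} → Eq u v ≤ Eq v u
  Eq-sym {u = u} {v} =
    ∧-univ ≤-refl (⊤-max ⟫ Eq-refl u ⟫ Eq-resp (≈.sym π₂-β) (≈.sym weaken-β))
    ⟫ Eq-subst-Eq π₂ (u ∘ π₁) u v ⟫ Eq-resp π₂-β weaken-β

  Eq-trans : ∀ {Z Y} {u v w : Hom Z Y} → Eq u v ∧ Eq v w ≤ Eq u w
  Eq-trans {u = u} {v} {w} =
    ∧-univ ∧-π₂ (∧-π₁ ⟫ Eq-resp (≈.sym weaken-β) (≈.sym π₂-β))
    ⟫ Eq-subst-Eq (u ∘ π₁) π₂ v w ⟫ Eq-resp weaken-β π₂-β

  Eq-cong : ∀ {Z Y W} {u v : Hom Z Y} (k : Hom (Z ⊗ Y) W) →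
            Eq u v ≤ Eq (k ∘ ⟨ id , u ⟩) (k ∘ ⟨ id , v ⟩)
  Eq-cong {u = u} {v} k =
    ∧-univ ≤-refl (⊤-max ⟫ Eq-refl (k ∘ ⟨ id , u ⟩) ⟫ Eq-resp (≈.sym (constant-β u)) ≈.refl)
    ⟫ Eq-subst-Eq (k ∘ ⟨ π₁ , u ∘ π₁ ⟩) k u v ⟫ Eq-resp (constant-β v) ≈.refl
    where
      constant-β : ∀ x → (k ∘ ⟨ π₁ , u ∘ π₁ ⟩) ∘ ⟨ id , x ⟩ ≈ k ∘ ⟨ id , u ⟩
      constant-β x = assoc ■ ∘ʳ (⟨⟩∘ ■ ⟨⟩-cong π₁-β weaken-β)

  every-predicate-descends : ∀ {A B} (ρ : P (A ⊗ B)) → des (δ {A} ⊠ δ {B}) ρ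
  every-predicate-descends {A} {B} ρ =
    ∧-univ (∧-π₂ ⟫ ∧-π₂)
      (∧-univ (∧-π₂ ⟫ ∧-π₁) (∧-π₁ ⟫ re-split (⟨⟩-η ■ ≈.sym pair-weakenʳ-β))
       ⟫ Eq-subst ρ₁ a a' ⟫ re-fuse pair-weakenʳ-β ⟫ re-split (≈.sym pair-weakenˡ-β))
    ⟫ Eq-subst ρ₂ b b' ⟫ re-fuse (pair-weakenˡ-β ■ ≈.sym ⟨⟩-η)
    where
      a a' : Hom ((A ⊗ B) ⊗ (A ⊗ B)) A
      a = π₁ ∘ π₁
      a' = π₁ ∘ π₂
      b b' : Hom ((A ⊗ B) ⊗ (A ⊗ B)) B
      b = π₂ ∘ π₁
      b' = π₂ ∘ π₂
      ρ₁ = re ⟨ π₂ , b ∘ π₁ ⟩ ρ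
      ρ₂ = re ⟨ a' ∘ π₁ , π₂ ⟩ ρ

  module ExtensionalQuotient {A B} (W : WeakEval A B) where
    open WeakEval W

    PointwiseEq : ∀ {T} → Hom T E → Hom T E → P (T ⊗ A)
    PointwiseEq u v = Eq (ev ∘ ⟨ u ∘ π₁ , π₂ ⟩) (ev ∘ ⟨ v ∘ π₁ , π₂ ⟩)

    ExtEq : P (E ⊗ E)
    ExtEq = ∀π (PointwiseEq π₁ π₂)

    private
      pair×ₘid : ∀ {T T'} {q : Hom T' E} {k : Hom T T'} →
                 ⟨ q ∘ π₁ , π₂ ⟩ ∘ (k ×ₘ id {A}) ≈ ⟨ (q ∘ k) ∘ π₁ , π₂ ⟩
      pair×ₘid = ⟨⟩∘ ■ ⟨⟩-cong (assoc ■ ∘ʳ π₁-β ■ ≈.sym assoc) (π₂-β ■ idˡ)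

      ev-at : ∀ {T} {u v : Hom T E} {q : Hom (E ⊗ E) E} {r : Hom T E} → q ∘ ⟨ u , v ⟩ ≈ r →
              (ev ∘ ⟨ q ∘ π₁ , π₂ ⟩) ∘ (⟨ u , v ⟩ ×ₘ id) ≈ ev ∘ ⟨ r ∘ π₁ , π₂ ⟩
      ev-at qr = assoc ■ ∘ʳ (pair×ₘid ■ ⟨⟩-cong (∘ˡ qr) ≈.refl)

    PointwiseEq-reindex : ∀ {T} {u v : Hom T E} →
                          re (⟨ u , v ⟩ ×ₘ id) (PointwiseEq π₁ π₂) ≤ PointwiseEq u v
    PointwiseEq-reindex = Eq-reindex ⟫ Eq-resp (ev-at π₁-β) (ev-at π₂-β)

    PointwiseEq-reindex⁻ : ∀ {T} {u v : Hom T E} →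
                           PointwiseEq u v ≤ re (⟨ u , v ⟩ ×ₘ id) (PointwiseEq π₁ π₂)
    PointwiseEq-reindex⁻ =
      Eq-resp (≈.sym (ev-at π₁-β)) (≈.sym (ev-at π₂-β)) ⟫ Eq-reindex⁻

    ExtEq-refl : δ ≤ ExtEq
    ExtEq-refl =
      ∀π-adj₂ (re-mono (re-id₂ ⟫ re-resp (≈.sym ⟨π₁,π₂⟩≈id)) ⟫ Eq-reindex
               ⟫ Eq-cong (ev ∘ ⟨ π₂ , π₂ ∘ π₁ ⟩)
               ⟫ Eq-resp (assoc ■ ∘ʳ pair-weakenʳ-β) (assoc ■ ∘ʳ pair-weakenʳ-β))

    ExtEq-sym : ExtEq ≤ re ⟨ π₂ , π₁ ⟩ ExtEq
    ExtEq-sym = ∀π-adj₂ (∀π-adj₁ ≤-refl ⟫ Eq-sym ⟫ PointwiseEq-reindex⁻) ⟫ ∀π-BC₂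

    ExtEq-trans : re ⟨ π₁ ∘ π₁ , π₂ ∘ π₁ ⟩ ExtEq ∧ re ⟨ π₂ ∘ π₁ , π₂ ⟩ ExtEq
                    ≤ re ⟨ π₁ ∘ π₁ , π₂ ⟩ ExtEq
    ExtEq-trans =
      ∧-mono ∀π-BC₁ ∀π-BC₁
      ⟫ ∀π-adj₂ (re-∧⁻ ⟫ ∧-mono (∀π-adj₁ ≤-refl ⟫ PointwiseEq-reindex)
                                 (∀π-adj₁ ≤-refl ⟫ PointwiseEq-reindex)
                 ⟫ Eq-trans ⟫ PointwiseEq-reindex⁻)
      ⟫ ∀π-BC₂

    ExtEq-isEqRel : IsEqRel ExtEq
    ExtEq-isEqRel = ExtEq-refl , ExtEq-sym , ExtEq-trans

    ev-isQArr : IsQArr (ExtEq ⊠ δ {A}) (δ {B}) ev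
    ev-isQArr =
      ∧-mono (∀π-inst {t = π₂ ∘ π₁} ⟫ Eq-reindex ⟫ Eq-resp ev-first ev-mixed)
             (Eq-cong (ev ∘ ⟨ (π₁ ∘ π₂) ∘ π₁ , π₂ ⟩)
              ⟫ Eq-resp (assoc ■ ∘ʳ pair-weakenˡ-β) (assoc ■ ∘ʳ (pair-weakenˡ-β ■ ≈.sym ⟨⟩-η)))
      ⟫ Eq-trans
      where
        ev-first : (ev ∘ ⟨ π₁ ∘ π₁ , π₂ ⟩) ∘ ⟨ ⟨ π₁ ∘ π₁ , π₁ ∘ π₂ ⟩ , π₂ ∘ π₁ ⟩ ≈ ev ∘ π₁
        ev-first = assoc ■ ∘ʳ (⟨⟩∘ ■ ⟨⟩-cong (assoc ■ ∘ʳ π₁-β ■ π₁-β) π₂-β ■ ≈.sym ⟨⟩-η)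
        ev-mixed : (ev ∘ ⟨ π₂ ∘ π₁ , π₂ ⟩) ∘ ⟨ ⟨ π₁ ∘ π₁ , π₁ ∘ π₂ ⟩ , π₂ ∘ π₁ ⟩
                   ≈ ev ∘ ⟨ π₁ ∘ π₂ , π₂ ∘ π₁ ⟩
        ev-mixed = assoc ■ ∘ʳ (⟨⟩∘ ■ ⟨⟩-cong (assoc ■ ∘ʳ π₁-β ■ π₂-β) π₂-β)

    -- The P-factorisation f' of f is already a morphism (X,ξ) → (E,ExtEq):
    -- if ξ(x,x') then f(x,-) = f(x',-) pointwise, because f preserves ξ ⊠ δ_A.
    quotient-factor : ∀ {X} (ξ : P (X ⊗ X)) → IsEqRel ξ →
                      (f : Hom (X ⊗ A) B) → IsQArr (ξ ⊠ δ {A}) (δ {B}) f →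
                      Σ (Hom X E) λ f' →
                        IsQArr ξ ExtEq f' × QEq (ξ ⊠ δ {A}) (δ {B}) f (ev ∘ (f' ×ₘ id))
    quotient-factor {X} ξ _ f f-arr with factor f
    ... | f' , f≈ = f' , (∀π-adj₂ ξ⇒pointwise ⟫ ∀π-BC₂) , (f-arr ⟫ Eq-resp ≈.refl (∘ˡ f≈))
      where
        m : Hom ((X ⊗ X) ⊗ A) ((X ⊗ A) ⊗ (X ⊗ A))
        m = ⟨ ⟨ π₁ ∘ π₁ , π₂ ⟩ , ⟨ π₂ ∘ π₁ , π₂ ⟩ ⟩
        ξ-with-same-a : re π₁ ξ ≤ re m (ξ ⊠ δ)
        ξ-with-same-a =
          ∧-univ (re-split (⟨⟩-η ■ ≈.sym (⟨⟩∘ ■ ⟨⟩-cong (assoc ■ ∘ʳ π₁-β ■ π₁-β)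
                                                        (assoc ■ ∘ʳ π₂-β ■ π₁-β))))
                 (⊤-max ⟫ Eq-refl π₂ ⟫ Eq-resp (≈.sym (assoc ■ ∘ʳ π₁-β ■ π₂-β))
                                               (≈.sym (assoc ■ ∘ʳ π₂-β ■ π₂-β))
                  ⟫ Eq-reindex⁻)
          ⟫ re-∧
        f-via-f' : ∀ {q : Hom (X ⊗ X) X} → f ∘ ⟨ q ∘ π₁ , π₂ ⟩ ≈ ev ∘ ⟨ (f' ∘ q) ∘ π₁ , π₂ ⟩
        f-via-f' = ∘ˡ f≈ ■ assoc ■ ∘ʳ (×ₘid∘⟨⟩ ■ ⟨⟩-cong (≈.sym assoc) ≈.refl)
        ξ⇒pointwise : re π₁ ξ ≤ re ((f' ×ₘ f') ×ₘ id) (PointwiseEq π₁ π₂)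
        ξ⇒pointwise =
          ξ-with-same-a ⟫ re-mono f-arr ⟫ Eq-reindex
          ⟫ Eq-resp (assoc ■ ∘ʳ π₁-β ■ f-via-f') (assoc ■ ∘ʳ π₂-β ■ f-via-f')
          ⟫ PointwiseEq-reindex⁻

    quotientWeakEval : QWeakEval A B
    quotientWeakEval = record
      { E = E ; ε = ExtEq ; ε-eq = ExtEq-isEqRel ; ev = ev
      ; ev-arr = ev-isQArr ; factor = quotient-factor }

  AUC-rhs-factor : ∀ {A B E E'} {w : Hom (E ⊗ A) B} {w' : Hom (E' ⊗ A) B}
                     (g : Hom E' E) → w' ≈ w ∘ (g ×ₘ id) →
                     (ρ : P (A ⊗ B)) → AUC-rhs w' ρ ≤ AUC-rhs w ρ
  AUC-rhs-factor {w = w} {w'} g w'≈ ρ =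
    ∃π-adj₂ (re-mono (∀π-mono (re-split along-g) ⟫ ∀π-BC₂) ⟫ re-fuse (≈.sym π₂-β)
             ⟫ re-∘₁ ⟫ re-mono (∃π-adj₁ ≤-refl) ⟫ re-fuse (π₁-β ■ idˡ))
    where
      along-g : ⟨ π₂ , w' ⟩ ≈ ⟨ π₂ , w ⟩ ∘ (g ×ₘ id)
      along-g = ⟨⟩-cong (≈.sym (π₂-β ■ idˡ)) w'≈ ■ ≈.sym ⟨⟩∘

corollary6p8 : ∀ {o h e p l} (𝒞 : CartCat o h e) (D : PrimaryDoctrine 𝒞 p l)
    (El : Elementary D) (Ex : Existential D) (Un : Universal D)
    (Im : Implicational D) (WC : WeakComprehensions D)
    (WCC : CartCat.WeaklyCCC 𝒞) (A B : CartCat.Ob 𝒞) →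
    AUCTheory.AUC-from D El Ex Un Im A B ⇔ AUCTheory.AUC̄-from D El Ex Un Im A B
corollary6p8 𝒞 D El Ex Un Im _ WCC A B = mk⇔ to from
  where
    open CartCat 𝒞 using (module WeakEval)
    open PrimaryDoctrine D using (≤-trans)
    open AUCTheory D El Ex Un Im
    open AUCTransfer 𝒞 D El Ex Un Im
    open ExtensionalQuotient using (quotientWeakEval)

    to : AUC-from A B → AUC̄-from A B
    to (W , auc) = quotientWeakEval W , λ ρ _ → auc ρ

    from : AUC̄-from A B → AUC-from A B
    from (Q , auc̄) with WeakEval.factor (WCC A B) (QWeakEval.ev Q)
    ... | g , ev≈ = WCC A B , λ ρ →
      ≤-trans (auc̄ ρ (every-predicate-descends ρ)) (AUC-rhs-factor g ev≈ ρ)
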